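{- Let $K$ be an algebraically closed field of characteristic $0$, let $u\in K$ be nonzero, and let $a,k$ be positive integers with $\gcd(k,a)=1$. Let $F(x)\in K(x)$ be a rational function having no pole at any zero of $1-ux^a$, and fix any $k$-th root $u^{1/k}\in K$ of $u$. Then $$\operatorname{CT}_x \underline{\frac{1}{1-u x^a}}\, F(x) \;=\; \operatorname{CT}_x \underline{\frac{1}{1-u^{1/k}x^a}}\, F(x^k).$$
   Context: Notation: for a nonzero $v\in K$, a positive integer $a$, and a rational function $G(x)\in K(x)$ with no pole at the zeros of $1-vx^a$, let $A(x)\in K[x]$ be the unique polynomial with $\deg A<a$ and $A(x)\equiv G(x)\pmod{\langle 1-vx^a\rangle}$ (i.e. $A$ agrees with $G$ at every zero of $1-vx^a$). Then $\operatorname{CT}_x \underline{\frac{1}{1-v x^a}}\, G(x)$ denotes $A(0)$. Equivalently, $A(x)$ is the numerator attached to the denominator factor $1-vx^a$ in the partial fraction decomposition of $G(x)/(1-vx^a)$ (when that factor is coprime to the other denominator factors), and the notation means the contribution of that single underlined factor to the constant term in $x$. -}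

module Defs where

open import Level using (Level; _⊔_) renaming (suc to lsuc)
open import Data.Nat using (ℕ; zero; suc)
open import Data.List using (List; []; _∷_)
open import Data.List.Relation.Unary.Any using (Any)
open import Data.Vec using (Vec; toList)
open import Data.Product using (Σ; ∃; _×_)
open import Relation.Nullary using (¬_)
open import Algebra.Bundles using (CommutativeRing)

record Field (c ℓ : Level) : Set (lsuc (c ⊔ ℓ)) where
  field
    commutativeRing : CommutativeRing c ℓ
  open CommutativeRing commutativeRing public
  field
    1≉0     : ¬ (1# ≈ 0#)
    inverse : ∀ x → ¬ (x ≈ 0#) → ∃ λ y → x * y ≈ 1#

module _ {c ℓ : Level} (K : Field c ℓ) where
  open Field K

  pow : Carrier → ℕ → Carrier
  pow x zero    = 1#
  pow x (suc n) = x * pow x n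

  natCast : ℕ → Carrier
  natCast zero    = 0#
  natCast (suc n) = 1# + natCast n

  -- Polynomials as coefficient lists, constant coefficient first.
  Poly : Set c
  Poly = List Carrier

  eval : Poly → Carrier → Carrier
  eval []      x = 0#
  eval (b ∷ p) x = b + x * eval p x

  CharZero : Set ℓ
  CharZero = ∀ n → ¬ (natCast (suc n) ≈ 0#)

  AlgClosed : Set (c ⊔ ℓ)
  AlgClosed = ∀ (b : Carrier) (p : Poly) → Any (λ e → ¬ (e ≈ 0#)) p →
              ∃ λ z → eval (b ∷ p) z ≈ 0#

  IsZeroOf : Carrier → ℕ → Carrier → Set ℓ
  IsZeroOf v a z = 1# + - (v * pow z a) ≈ 0#

  -- IsCT v a num den t :  t = CT_x (underlined 1/(1 - v x^a)) G(x),
  -- where G(x) = num(x)/den(x).  That is, t = A(0) for a polynomial A of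
  -- degree < a (given by its a coefficients) with A(z) = G(z), i.e.
  -- A(z)·den(z) = num(z), at every zero z of 1 - v x^a.
  IsCT : Carrier → (a : ℕ) → (Carrier → Carrier) → (Carrier → Carrier) →
         Carrier → Set (c ⊔ ℓ)
  IsCT v a num den t =
    Σ (Vec Carrier a) λ A →
      (∀ z → IsZeroOf v a z → eval (toList A) z * den z ≈ num z) ×
      (t ≈ eval (toList A) 0#)

-- Both constant terms are A(0) for the polynomial A of degree < a that agrees
-- with N/D at the zeros of the underlined factor. In characteristic zero those
-- zeros are simple, so over an algebraically closed field there are exactly a of
-- them; hence A exists (interpolation) and A(0) is unique (a polynomial of
-- degree < a with a zeros vanishes). If A works for 1 - u x^a, then reducing
-- A(y^k) modulo y^a = 1/w gives a polynomial B of degree < a that works for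
-- 1 - w y^a, because y ↦ y^k maps zeros of 1 - w y^a to zeros of 1 - u x^a.
-- Since k and a are coprime, y^(kj) with 0 < j < a reduces to a non-constant
-- monomial, so B(0) = A(0).

module Submission where

open import Defs
open import Level using (Level; _⊔_)
open import Algebra.Bundles using (CommutativeRing)
open import Algebra.Solver.Ring.AlmostCommutativeRing using (_-Raw-AlmostCommutative⟶_; fromCommutativeRing)
open import Data.Nat as ℕ using (ℕ; zero; suc; _∸_; _≤_; _<_; z≤n; s≤s)
import Data.Nat.Properties as ℕ
open import Data.Nat.DivMod using (_/_; _%_; m≡m%n+[m/n]*n; m%n<n)
open import Data.Nat.Divisibility using (_∣_; m%n≡0⇒n∣m; ∣⇒≤)
open import Data.Nat.Coprimality as Coprimality using (Coprime; coprime-divisor; gcd≡1⇒coprime)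
open import Data.Nat.GCD using (gcd)
open import Data.Integer as ℤ using (ℤ; +_; -[1+_]; _⊖_)
import Data.Integer.Properties as ℤ
open import Data.Sign as Sign using (Sign)
open import Data.Maybe using (Maybe; just; nothing)
open import Data.List using (List; []; _∷_; length; map)
open import Data.List.Properties using (length-map)
open import Data.List.Relation.Unary.All as All using (All; []; _∷_)
open import Data.List.Relation.Unary.Any using (Any; here; there)
open import Data.List.Relation.Unary.AllPairs using (AllPairs; []; _∷_)
open import Data.Vec using (Vec; []; _∷_; toList)
open import Data.Vec.Properties using (length-toList)
open import Data.Product using (Σ; ∃; _×_; _,_; proj₁; proj₂)
open import Data.Empty using (⊥-elim)
open import Function using (id)
open import Relation.Binary.PropositionalEquality as ≡ using (_≡_; _≢_)
open import Relation.Nullary using (¬_; yes; no)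

-- The ring solver needs a coefficient ring with decidable equality in order
-- to cancel terms such as x - x; ℤ maps into every commutative ring.
module IntegerCoefficients {c ℓ : Level} (R : CommutativeRing c ℓ) where
  open CommutativeRing R
  open import Algebra.Properties.Ring ring
  open import Algebra.Properties.CommutativeSemigroup *-commutativeSemigroup using (interchange)
  open import Algebra.Properties.Semiring.Mult.TCOptimised semiring
    using (×-homo-+; ×1-homo-*) renaming (_×_ to _×′_)
  open import Relation.Binary.Reasoning.Setoid setoid

  private
    -- Built from _×′_ so that fromℤ (+ 1) is definitionally 1#, as the
    -- solver requires of the constant con (+ 1).
    fromℤ : ℤ → Carrier
    fromℤ (+ n)      = n ×′ 1#
    fromℤ -[1+ n ] = - (suc n ×′ 1#)

    ⊖-homo : ∀ m n → fromℤ (m ⊖ n) ≈ m ×′ 1# - n ×′ 1#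
    ⊖-homo m zero = sym (trans (+-congˡ -0#≈0#) (+-identityʳ _))
    ⊖-homo zero (suc n) = sym (+-identityˡ _)
    ⊖-homo (suc m) (suc n) = begin
      fromℤ (suc m ⊖ suc n)             ≡⟨ ≡.cong fromℤ (ℤ.[1+m]⊖[1+n]≡m⊖n m n) ⟩
      fromℤ (m ⊖ n)                     ≈⟨ ⊖-homo m n ⟩
      m ×′ 1# - n ×′ 1#                   ≈⟨ +-congˡ (+-identityˡ _) ⟨
      m ×′ 1# + (0# - n ×′ 1#)            ≈⟨ +-congˡ (+-congʳ (-‿inverseʳ 1#)) ⟨
      m ×′ 1# + ((1# - 1#) - n ×′ 1#)     ≈⟨ +-congˡ (+-assoc 1# (- 1#) _) ⟩
      m ×′ 1# + (1# + (- 1# - n ×′ 1#))   ≈⟨ +-assoc (m ×′ 1#) 1# _ ⟨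
      (m ×′ 1# + 1#) + (- 1# - n ×′ 1#)   ≈⟨ +-cong (+-comm _ 1#) (-‿+-comm 1# _) ⟩
      (1# + m ×′ 1#) - (1# + n ×′ 1#)     ≈⟨ +-cong (×-homo-+ 1# 1 m) (-‿cong (×-homo-+ 1# 1 n)) ⟨
      suc m ×′ 1# - suc n ×′ 1#           ∎

    sign : Sign → Carrier
    sign Sign.+ = 1#
    sign Sign.- = - 1#

    sign-homo : ∀ s t → sign (s Sign.* t) ≈ sign s * sign t
    sign-homo Sign.+ t       = sym (*-identityˡ _)
    sign-homo Sign.- Sign.+ = sym (*-identityʳ _)
    sign-homo Sign.- Sign.- = sym (trans (-1*x≈-x _) (-‿involutive 1#))

    ◃-homo : ∀ s n → fromℤ (s ℤ.◃ n) ≈ sign s * n ×′ 1#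
    ◃-homo s       zero    = sym (zeroʳ _)
    ◃-homo Sign.+ (suc n) = sym (*-identityˡ _)
    ◃-homo Sign.- (suc n) = sym (-1*x≈-x _)

    fromℤ-sign-abs : ∀ i → fromℤ i ≈ sign (ℤ.sign i) * ℤ.∣ i ∣ ×′ 1#
    fromℤ-sign-abs i = trans (reflexive (≡.cong fromℤ (≡.sym (ℤ.◃-inverse i)))) (◃-homo (ℤ.sign i) ℤ.∣ i ∣)

    *-homo : ∀ i j → fromℤ (i ℤ.* j) ≈ fromℤ i * fromℤ j
    *-homo i j = begin
      fromℤ (i ℤ.* j)                                  ≈⟨ ◃-homo (ℤ.sign i Sign.* ℤ.sign j) (ℤ.∣ i ∣ ℕ.* ℤ.∣ j ∣) ⟩
      sign (ℤ.sign i Sign.* ℤ.sign j) * (ℤ.∣ i ∣ ℕ.* ℤ.∣ j ∣) ×′ 1#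
        ≈⟨ *-cong (sign-homo (ℤ.sign i) (ℤ.sign j)) (×1-homo-* ℤ.∣ i ∣ ℤ.∣ j ∣) ⟩
      (sign (ℤ.sign i) * sign (ℤ.sign j)) * (ℤ.∣ i ∣ ×′ 1# * ℤ.∣ j ∣ ×′ 1#)
        ≈⟨ interchange _ _ _ _ ⟩
      (sign (ℤ.sign i) * ℤ.∣ i ∣ ×′ 1#) * (sign (ℤ.sign j) * ℤ.∣ j ∣ ×′ 1#)
        ≈⟨ *-cong (fromℤ-sign-abs i) (fromℤ-sign-abs j) ⟨
      fromℤ i * fromℤ j                                ∎

    +-homo : ∀ i j → fromℤ (i ℤ.+ j) ≈ fromℤ i + fromℤ j
    +-homo -[1+ m ] -[1+ n ] = begin
      - (suc (suc (m ℕ.+ n)) ×′ 1#)    ≡⟨ ≡.cong (λ k → - (k ×′ 1#)) (≡.sym (ℕ.+-suc (suc m) n)) ⟩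
      - ((suc m ℕ.+ suc n) ×′ 1#)      ≈⟨ -‿cong (×-homo-+ 1# (suc m) (suc n)) ⟩
      - (suc m ×′ 1# + suc n ×′ 1#)     ≈⟨ -‿+-comm _ _ ⟨
      - (suc m ×′ 1#) - suc n ×′ 1#     ∎
    +-homo -[1+ m ] (+ n)    = trans (⊖-homo n (suc m)) (+-comm _ _)
    +-homo (+ m)    -[1+ n ] = ⊖-homo m (suc n)
    +-homo (+ m)    (+ n)    = ×-homo-+ 1# m n

    -‿homo : ∀ i → fromℤ (ℤ.- i) ≈ - fromℤ i
    -‿homo -[1+ n ]  = sym (-‿involutive _)
    -‿homo (+ zero)  = sym -0#≈0#
    -‿homo (+ suc n) = refl

    homomorphism : ℤ.+-*-rawRing -Raw-AlmostCommutative⟶ fromCommutativeRing R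
    homomorphism = record
      { ⟦_⟧ = fromℤ ; +-homo = +-homo ; *-homo = *-homo ; -‿homo = -‿homo
      ; 0-homo = refl ; 1-homo = refl }

    ≟-weakly : ∀ i j → Maybe (fromℤ i ≈ fromℤ j)
    ≟-weakly i j with i ℤ.≟ j
    ... | yes i≡j = just (reflexive (≡.cong fromℤ i≡j))
    ... | no  _   = nothing

  open import Algebra.Solver.Ring ℤ.+-*-rawRing (fromCommutativeRing R) homomorphism ≟-weakly public

module PolynomialsOver {c ℓ : Level} (K : Field c ℓ) where
  open Field K
  open import Algebra.Properties.Ring ring
  open import Algebra.Properties.Semiring.Exp semiring
  open import Algebra.Properties.CommutativeSemiring.Exp commutativeSemiring using (^-distrib-*)
  open import Relation.Binary.Reasoning.Setoid setoid
  open IntegerCoefficients commutativeRing using (solve; _:=_; _:+_; _:-_; _:*_; :-_; con)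

  pow≡^ : ∀ x n → pow K x n ≡ x ^ n
  pow≡^ x zero    = ≡.refl
  pow≡^ x (suc n) = ≡.cong (x *_) (pow≡^ x n)

  x*y≈0⇒y≈0 : ∀ {x y} → x ≉ 0# → x * y ≈ 0# → y ≈ 0#
  x*y≈0⇒y≈0 {x} {y} x≉0 xy≈0 with inverse x x≉0
  ... | x⁻¹ , xx⁻¹≈1 = begin
    y                ≈⟨ *-identityˡ y ⟨
    1# * y           ≈⟨ *-congʳ xx⁻¹≈1 ⟨
    (x * x⁻¹) * y    ≈⟨ solve 3 (λ x x⁻¹ y → (x :* x⁻¹) :* y := x⁻¹ :* (x :* y)) refl x x⁻¹ y ⟩
    x⁻¹ * (x * y)    ≈⟨ *-congˡ xy≈0 ⟩
    x⁻¹ * 0#         ≈⟨ zeroʳ x⁻¹ ⟩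
    0#               ∎

  *-nonzero : ∀ {x y} → x ≉ 0# → y ≉ 0# → x * y ≉ 0#
  *-nonzero x≉0 y≉0 xy≈0 = y≉0 (x*y≈0⇒y≈0 x≉0 xy≈0)

  -‿nonzero : ∀ {x} → x ≉ 0# → - x ≉ 0#
  -‿nonzero x≉0 -x≈0 = x≉0 (-‿injective (trans -x≈0 (sym -0#≈0#)))

  ^-nonzero : ∀ {x} → x ≉ 0# → ∀ n → x ^ n ≉ 0#
  ^-nonzero x≉0 zero    = 1≉0
  ^-nonzero x≉0 (suc n) = *-nonzero x≉0 (^-nonzero x≉0 n)

  1^n≈1 : ∀ n → 1# ^ n ≈ 1#
  1^n≈1 zero    = refl
  1^n≈1 (suc n) = trans (*-identityˡ _) (1^n≈1 n)

  -- Arithmetic of coefficient lists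

  ⟦_⟧ : Poly K → Carrier → Carrier
  ⟦_⟧ = eval K

  ⟦⟧-cong : ∀ p {x y} → x ≈ y → ⟦ p ⟧ x ≈ ⟦ p ⟧ y
  ⟦⟧-cong []      x≈y = refl
  ⟦⟧-cong (b ∷ p) x≈y = +-congˡ (*-cong x≈y (⟦⟧-cong p x≈y))

  infixl 6 _⊕_ _⊝_

  _⊕_ : Poly K → Poly K → Poly K
  []      ⊕ q       = q
  (a ∷ p) ⊕ []      = a ∷ p
  (a ∷ p) ⊕ (b ∷ q) = a + b ∷ p ⊕ q

  ⟦⟧-⊕ : ∀ p q y → ⟦ p ⊕ q ⟧ y ≈ ⟦ p ⟧ y + ⟦ q ⟧ y
  ⟦⟧-⊕ []      q       y = sym (+-identityˡ _)
  ⟦⟧-⊕ (a ∷ p) []      y = sym (+-identityʳ _)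
  ⟦⟧-⊕ (a ∷ p) (b ∷ q) y = begin
    (a + b) + y * ⟦ p ⊕ q ⟧ y             ≈⟨ +-congˡ (*-congˡ (⟦⟧-⊕ p q y)) ⟩
    (a + b) + y * (⟦ p ⟧ y + ⟦ q ⟧ y)
      ≈⟨ solve 5 (λ a b y P Q → (a :+ b) :+ y :* (P :+ Q) := (a :+ y :* P) :+ (b :+ y :* Q))
          refl a b y (⟦ p ⟧ y) (⟦ q ⟧ y) ⟩
    (a + y * ⟦ p ⟧ y) + (b + y * ⟦ q ⟧ y) ∎

  length-⊕ : ∀ p q {n} → length p ≤ n → length q ≤ n → length (p ⊕ q) ≤ n
  length-⊕ []      q       _         q≤n       = q≤n
  length-⊕ (a ∷ p) []      p≤n       _         = p≤n
  length-⊕ (a ∷ p) (b ∷ q) (s≤s p≤n) (s≤s q≤n) = s≤s (length-⊕ p q p≤n q≤n)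

  scale : Carrier → Poly K → Poly K
  scale a = map (a *_)

  ⟦⟧-scale : ∀ a p y → ⟦ scale a p ⟧ y ≈ a * ⟦ p ⟧ y
  ⟦⟧-scale a []      y = sym (zeroʳ a)
  ⟦⟧-scale a (b ∷ p) y = begin
    a * b + y * ⟦ scale a p ⟧ y  ≈⟨ +-congˡ (*-congˡ (⟦⟧-scale a p y)) ⟩
    a * b + y * (a * ⟦ p ⟧ y)
      ≈⟨ solve 4 (λ a b y P → a :* b :+ y :* (a :* P) := a :* (b :+ y :* P)) refl a b y (⟦ p ⟧ y) ⟩
    a * (b + y * ⟦ p ⟧ y)        ∎

  _⊝_ : Poly K → Poly K → Poly K
  p ⊝ q = p ⊕ scale (- 1#) q

  length-scale : ∀ a p → length (scale a p) ≡ length p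
  length-scale a p = length-map (a *_) p

  ⟦⟧-⊝ : ∀ p q y → ⟦ p ⊝ q ⟧ y ≈ ⟦ p ⟧ y - ⟦ q ⟧ y
  ⟦⟧-⊝ p q y = trans (⟦⟧-⊕ p _ y) (+-congˡ (trans (⟦⟧-scale (- 1#) q y) (-1*x≈-x _)))


  infixl 7 _⊛_

  _⊛_ : Poly K → Poly K → Poly K
  []      ⊛ q = []
  (a ∷ p) ⊛ q = scale a q ⊕ (0# ∷ p ⊛ q)

  ⟦⟧-⊛ : ∀ p q y → ⟦ p ⊛ q ⟧ y ≈ ⟦ p ⟧ y * ⟦ q ⟧ y
  ⟦⟧-⊛ []      q y = sym (zeroˡ _)
  ⟦⟧-⊛ (a ∷ p) q y = begin
    ⟦ scale a q ⊕ (0# ∷ p ⊛ q) ⟧ y          ≈⟨ ⟦⟧-⊕ (scale a q) (0# ∷ p ⊛ q) y ⟩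
    ⟦ scale a q ⟧ y + (0# + y * ⟦ p ⊛ q ⟧ y) ≈⟨ +-cong (⟦⟧-scale a q y) (+-congˡ (*-congˡ (⟦⟧-⊛ p q y))) ⟩
    a * ⟦ q ⟧ y + (0# + y * (⟦ p ⟧ y * ⟦ q ⟧ y))
      ≈⟨ solve 4 (λ a y P Q → a :* Q :+ (con (+ 0) :+ y :* (P :* Q)) := (a :+ y :* P) :* Q)
          refl a y (⟦ p ⟧ y) (⟦ q ⟧ y) ⟩
    (a + y * ⟦ p ⟧ y) * ⟦ q ⟧ y              ∎

  X-_*_ : Carrier → Poly K → Poly K
  X- z * p = (0# ∷ p) ⊕ scale (- z) p

  ⟦⟧-X-* : ∀ z p y → ⟦ X- z * p ⟧ y ≈ (y - z) * ⟦ p ⟧ y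
  ⟦⟧-X-* z p y = begin
    ⟦ (0# ∷ p) ⊕ scale (- z) p ⟧ y           ≈⟨ ⟦⟧-⊕ (0# ∷ p) (scale (- z) p) y ⟩
    (0# + y * ⟦ p ⟧ y) + ⟦ scale (- z) p ⟧ y  ≈⟨ +-congˡ (⟦⟧-scale (- z) p y) ⟩
    (0# + y * ⟦ p ⟧ y) + - z * ⟦ p ⟧ y
      ≈⟨ solve 3 (λ y z P → (con (+ 0) :+ y :* P) :+ :- z :* P := (y :- z) :* P) refl y z (⟦ p ⟧ y) ⟩
    (y - z) * ⟦ p ⟧ y                          ∎

  length-X-* : ∀ z p → length (X- z * p) ≤ suc (length p)
  length-X-* z p = length-⊕ (0# ∷ p) (scale (- z) p) ℕ.≤-refl
    (ℕ.m≤n⇒m≤1+n (ℕ.≤-reflexive (length-scale (- z) p)))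

  ∏X- : List Carrier → Carrier → Carrier
  ∏X- []       y = 1#
  ∏X- (z ∷ zs) y = (y - z) * ∏X- zs y

  ∏[X-_] : List Carrier → Poly K
  ∏[X- [] ]     = 1# ∷ []
  ∏[X- z ∷ zs ] = X- z * ∏[X- zs ]

  ⟦⟧-∏ : ∀ zs y → ⟦ ∏[X- zs ] ⟧ y ≈ ∏X- zs y
  ⟦⟧-∏ []       y = trans (+-congˡ (zeroʳ y)) (+-identityʳ 1#)
  ⟦⟧-∏ (z ∷ zs) y = trans (⟦⟧-X-* z ∏[X- zs ] y) (*-congˡ (⟦⟧-∏ zs y))

  length-∏ : ∀ zs → length ∏[X- zs ] ≤ suc (length zs)
  length-∏ []       = ℕ.≤-refl
  length-∏ (z ∷ zs) = ℕ.≤-trans (length-X-* z ∏[X- zs ]) (s≤s (length-∏ zs))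

  ∏X-≈0 : ∀ {zs} → All (λ x → ∏X- zs x ≈ 0#) zs
  ∏X-≈0 {[]}     = []
  ∏X-≈0 {z ∷ zs} = trans (*-congʳ (-‿inverseʳ z)) (zeroˡ _)
                 ∷ All.map (λ e → trans (*-congˡ e) (zeroʳ _)) ∏X-≈0

  monomial : ℕ → Carrier → Poly K
  monomial zero    a = a ∷ []
  monomial (suc n) a = 0# ∷ monomial n a

  ⟦⟧-monomial : ∀ n a y → ⟦ monomial n a ⟧ y ≈ a * y ^ n
  ⟦⟧-monomial zero    a y = solve 2 (λ a y → a :+ y :* con (+ 0) := a :* con (+ 1)) refl a y
  ⟦⟧-monomial (suc n) a y = trans (+-congˡ (*-congˡ (⟦⟧-monomial n a y)))
    (solve 3 (λ y a Y → con (+ 0) :+ y :* (a :* Y) := a :* (y :* Y)) refl y a (y ^ n))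

  length-monomial : ∀ n a → length (monomial n a) ≡ suc n
  length-monomial zero    a = ≡.refl
  length-monomial (suc n) a = ≡.cong suc (length-monomial n a)

  ⟦monomial⟧-at-0 : ∀ n b → n ≢ 0 → ⟦ monomial n b ⟧ 0# ≈ 0#
  ⟦monomial⟧-at-0 zero    b n≢0 = ⊥-elim (n≢0 ≡.refl)
  ⟦monomial⟧-at-0 (suc n) b _   = trans (+-identityˡ _) (zeroˡ _)

  pad : ∀ {n} (p : Poly K) → length p ≤ n → Vec Carrier n
  pad {zero}  []      _         = []
  pad {suc n} []      _         = 0# ∷ pad [] z≤n
  pad {suc n} (x ∷ p) (s≤s p≤n) = x ∷ pad p p≤n

  ⟦⟧-pad : ∀ {n} (p : Poly K) (p≤n : length p ≤ n) y → ⟦ toList (pad p p≤n) ⟧ y ≈ ⟦ p ⟧ y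
  ⟦⟧-pad {zero}  []      _         y = refl
  ⟦⟧-pad {suc n} []      _         y =
    trans (+-congˡ (*-congˡ (⟦⟧-pad {n} [] z≤n y))) (trans (+-congˡ (zeroʳ y)) (+-identityʳ 0#))
  ⟦⟧-pad {suc n} (x ∷ p) (s≤s p≤n) y = +-congˡ (*-congˡ (⟦⟧-pad p p≤n y))

  -- Division by linear factors, zeros and interpolation

  -- Synthetic division by X - z: the quotient's coefficients are the values
  -- at z of the proper tails of p.
  quotient : Carrier → Poly K → Poly K
  quotient z []          = []
  quotient z (b ∷ [])    = []
  quotient z (b ∷ c ∷ p) = ⟦ c ∷ p ⟧ z ∷ quotient z (c ∷ p)

  ⟦⟧-quotient : ∀ z p y → ⟦ p ⟧ y ≈ (y - z) * ⟦ quotient z p ⟧ y + ⟦ p ⟧ z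
  ⟦⟧-quotient z []          y = solve 2 (λ y z → con (+ 0) := (y :- z) :* con (+ 0) :+ con (+ 0)) refl y z
  ⟦⟧-quotient z (b ∷ [])    y =
    solve 3 (λ b y z → b :+ y :* con (+ 0) := (y :- z) :* con (+ 0) :+ (b :+ z :* con (+ 0))) refl b y z
  ⟦⟧-quotient z (b ∷ c ∷ p) y = begin
    b + y * ⟦ c ∷ p ⟧ y                              ≈⟨ +-congˡ (*-congˡ (⟦⟧-quotient z (c ∷ p) y)) ⟩
    b + y * ((y - z) * Q + C)
      ≈⟨ solve 5 (λ b y z Q C → b :+ y :* ((y :- z) :* Q :+ C) := (y :- z) :* (C :+ y :* Q) :+ (b :+ z :* C))
          refl b y z Q C ⟩
    (y - z) * (C + y * Q) + (b + z * C)              ∎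
    where
    Q C : Carrier
    Q = ⟦ quotient z (c ∷ p) ⟧ y
    C = ⟦ c ∷ p ⟧ z

  factor-root : ∀ {z} p → ⟦ p ⟧ z ≈ 0# → ∀ y → ⟦ p ⟧ y ≈ (y - z) * ⟦ quotient z p ⟧ y
  factor-root {z} p pz≈0 y = trans (⟦⟧-quotient z p y) (trans (+-congˡ pz≈0) (+-identityʳ _))

  length-quotient : ∀ z p → length (quotient z p) ≡ length p ∸ 1
  length-quotient z []          = ≡.refl
  length-quotient z (b ∷ [])    = ≡.refl
  length-quotient z (b ∷ c ∷ p) = ≡.cong suc (length-quotient z (c ∷ p))

  -- The last entry, as lists start with the constant coefficient.
  lead : Poly K → Carrier
  lead []          = 0#
  lead (b ∷ [])    = b
  lead (b ∷ c ∷ p) = lead (c ∷ p)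

  lead-quotient : ∀ z b c p → lead (quotient z (b ∷ c ∷ p)) ≈ lead (c ∷ p)
  lead-quotient z b c []      = trans (+-congˡ (zeroʳ z)) (+-identityʳ c)
  lead-quotient z b c (d ∷ p) = lead-quotient z c d p

  lead≉0⇒nonzero-coefficient : ∀ p → lead p ≉ 0# → Any (_≉ 0#) p
  lead≉0⇒nonzero-coefficient []          lead≉0 = ⊥-elim (lead≉0 refl)
  lead≉0⇒nonzero-coefficient (b ∷ [])    lead≉0 = here lead≉0
  lead≉0⇒nonzero-coefficient (b ∷ c ∷ p) lead≉0 = there (lead≉0⇒nonzero-coefficient (c ∷ p) lead≉0)

  splits : AlgClosed K → ∀ n p → length p ≡ suc n → lead p ≉ 0# →
    ∃ λ zs → length zs ≡ n × (∀ y → ⟦ p ⟧ y ≈ lead p * ∏X- zs y)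
  splits closed zero    (b ∷ [])    _ _ =
    [] , ≡.refl , λ y → trans (+-congˡ (zeroʳ y)) (trans (+-identityʳ b) (sym (*-identityʳ b)))
  splits closed (suc n) (b ∷ c ∷ p) length-p lead≉0
    with closed b (c ∷ p) (lead≉0⇒nonzero-coefficient (c ∷ p) lead≉0)
  ... | z , pz≈0
    with splits closed n (quotient z (b ∷ c ∷ p))
           (≡.trans (length-quotient z (b ∷ c ∷ p)) (ℕ.suc-injective length-p))
           (λ e → lead≉0 (trans (sym (lead-quotient z b c p)) e))
  ... | zs , length-zs , q≈∏ = z ∷ zs , ≡.cong suc length-zs , λ y → begin
    ⟦ b ∷ c ∷ p ⟧ y                         ≈⟨ factor-root (b ∷ c ∷ p) pz≈0 y ⟩
    (y - z) * ⟦ q ⟧ y                        ≈⟨ *-congˡ (q≈∏ y) ⟩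
    (y - z) * (lead q * ∏X- zs y)
      ≈⟨ solve 4 (λ y z l P → (y :- z) :* (l :* P) := l :* ((y :- z) :* P)) refl y z (lead q) (∏X- zs y) ⟩
    lead q * ((y - z) * ∏X- zs y)            ≈⟨ *-congʳ (lead-quotient z b c p) ⟩
    lead (c ∷ p) * ((y - z) * ∏X- zs y)      ∎
    where q = quotient z (b ∷ c ∷ p)

  Distinct : List Carrier → Set (c ⊔ ℓ)
  Distinct = AllPairs _≉_

  quotient-zeros : ∀ {z} p → ⟦ p ⟧ z ≈ 0# → ∀ {xs} → All (z ≉_) xs → All (λ x → ⟦ p ⟧ x ≈ 0#) xs →
    All (λ x → ⟦ quotient z p ⟧ x ≈ 0#) xs
  quotient-zeros p pz≈0 []           []             = []
  quotient-zeros p pz≈0 (z≉x ∷ z≉xs) (px≈0 ∷ pxs≈0) =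
    x*y≈0⇒y≈0 (λ e → z≉x (sym (x∙y⁻¹≈ε⇒x≈y _ _ e))) (trans (sym (factor-root p pz≈0 _)) px≈0)
    ∷ quotient-zeros p pz≈0 z≉xs pxs≈0

  factor-roots : ∀ {zs} → Distinct zs → ∀ p → All (λ z → ⟦ p ⟧ z ≈ 0#) zs →
    ∃ λ q → (∀ y → ⟦ p ⟧ y ≈ ∏X- zs y * ⟦ q ⟧ y) × length q ≡ length p ∸ length zs
  factor-roots [] p [] = p , (λ y → sym (*-identityˡ _)) , ≡.refl
  factor-roots {z ∷ zs} (z≉zs ∷ distinct) p (pz≈0 ∷ pzs≈0)
    with factor-roots distinct (quotient z p) (quotient-zeros p pz≈0 z≉zs pzs≈0)
  ... | q , p≈∏q , length-q = q ,
    (λ y → trans (factor-root p pz≈0 y) (trans (*-congˡ (p≈∏q y)) (sym (*-assoc _ _ _)))) ,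
    ≡.trans length-q (≡.trans (≡.cong (_∸ length zs) (length-quotient z p)) (ℕ.∸-+-assoc (length p) 1 (length zs)))

  vanishes-everywhere : ∀ {zs} → Distinct zs → ∀ p → length p ≤ length zs →
    All (λ z → ⟦ p ⟧ z ≈ 0#) zs → ∀ y → ⟦ p ⟧ y ≈ 0#
  vanishes-everywhere distinct p p≤zs pzs≈0 y with factor-roots distinct p pzs≈0
  ... | []    , p≈∏q , _        = trans (p≈∏q y) (zeroʳ _)
  ... | _ ∷ _ , _    , length-q = ⊥-elim (ℕ.1+n≢0 (≡.trans length-q (ℕ.m≤n⇒m∸n≡0 p≤zs)))

  vanishes-at-zeros-of-∏ : ∀ {zs} → Distinct zs → ∀ p → All (λ z → ⟦ p ⟧ z ≈ 0#) zs →
    ∀ {y} → ∏X- zs y ≈ 0# → ⟦ p ⟧ y ≈ 0#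
  vanishes-at-zeros-of-∏ distinct p pzs≈0 {y} ∏≈0 with factor-roots distinct p pzs≈0
  ... | q , p≈∏q , _ = trans (p≈∏q y) (trans (*-congʳ ∏≈0) (zeroˡ _))

  avoids⇒∏X-≉0 : ∀ {z zs} → All (z ≉_) zs → ∏X- zs z ≉ 0#
  avoids⇒∏X-≉0 []           = 1≉0
  avoids⇒∏X-≉0 (z≉x ∷ z≉xs) = *-nonzero (λ e → z≉x (x∙y⁻¹≈ε⇒x≈y _ _ e)) (avoids⇒∏X-≉0 z≉xs)

  ∏X-≉0⇒avoids : ∀ {z} zs → ∏X- zs z ≉ 0# → All (z ≉_) zs
  ∏X-≉0⇒avoids []       _      = []
  ∏X-≉0⇒avoids (x ∷ xs) ∏≉0 =
    (λ z≈x → ∏≉0 (trans (*-congʳ (x≈y⇒x∙y⁻¹≈ε z≈x)) (zeroˡ _)))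
    ∷ ∏X-≉0⇒avoids xs (λ e → ∏≉0 (trans (*-congˡ e) (zeroʳ _)))

  interpolate : ∀ {zs} → Distinct zs → (g h : Carrier → Carrier) → All (λ z → h z ≉ 0#) zs →
    ∃ λ p → length p ≤ length zs × All (λ z → ⟦ p ⟧ z * h z ≈ g z) zs
  interpolate []                   g h []             = [] , z≤n , []
  interpolate {z ∷ zs} (z≉zs ∷ distinct) g h (hz≉0 ∷ hzs≉0)
    with interpolate distinct g h hzs≉0 | inverse (h z * ∏X- zs z) (*-nonzero hz≉0 (avoids⇒∏X-≉0 z≉zs))
  ... | p , length-p , p-fits | d⁻¹ , dd⁻¹≈1 = p′ , length-p′ , p′-fits-z ∷ p′-fits-zs
    where
    κ : Carrier
    κ = (g z - ⟦ p ⟧ z * h z) * d⁻¹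
    p′ : Poly K
    p′ = p ⊕ scale κ ∏[X- zs ]
    ⟦p′⟧ : ∀ y → ⟦ p′ ⟧ y ≈ ⟦ p ⟧ y + κ * ∏X- zs y
    ⟦p′⟧ y = trans (⟦⟧-⊕ p _ y) (+-congˡ (trans (⟦⟧-scale κ ∏[X- zs ] y) (*-congˡ (⟦⟧-∏ zs y))))
    length-p′ : length p′ ≤ suc (length zs)
    length-p′ = length-⊕ p _ (ℕ.m≤n⇒m≤1+n length-p)
      (ℕ.≤-trans (ℕ.≤-reflexive (length-scale κ ∏[X- zs ])) (length-∏ zs))
    p′-fits-z : ⟦ p′ ⟧ z * h z ≈ g z
    p′-fits-z = begin
      ⟦ p′ ⟧ z * h z                                 ≈⟨ *-congʳ (⟦p′⟧ z) ⟩
      (⟦ p ⟧ z + κ * ∏X- zs z) * h z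
        ≈⟨ solve 5 (λ P G H i Π → (P :+ ((G :- P :* H) :* i) :* Π) :* H
                                  := P :* H :+ (G :- P :* H) :* ((H :* Π) :* i))
                   refl (⟦ p ⟧ z) (g z) (h z) d⁻¹ (∏X- zs z) ⟩
      ⟦ p ⟧ z * h z + (g z - ⟦ p ⟧ z * h z) * (h z * ∏X- zs z * d⁻¹)
        ≈⟨ +-congˡ (*-congˡ dd⁻¹≈1) ⟩
      ⟦ p ⟧ z * h z + (g z - ⟦ p ⟧ z * h z) * 1#
        ≈⟨ solve 2 (λ P G → P :+ (G :- P) :* con (+ 1) := G) refl (⟦ p ⟧ z * h z) (g z) ⟩
      g z                                            ∎
    p′-fits-zs : All (λ x → ⟦ p′ ⟧ x * h x ≈ g x) zs
    p′-fits-zs = All.zipWith (λ (fits , ∏≈0) → trans (*-congʳ (p′≈p ∏≈0)) fits) (p-fits , ∏X-≈0)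
      where
      p′≈p : ∀ {x} → ∏X- zs x ≈ 0# → ⟦ p′ ⟧ x ≈ ⟦ p ⟧ x
      p′≈p {x} ∏≈0 = trans (⟦p′⟧ x) (trans (+-congˡ (trans (*-congˡ ∏≈0) (zeroʳ κ))) (+-identityʳ _))

  -- The zeros of 1 - v X^(a+1)

  Separable : (Carrier → Carrier) → Set (c ⊔ ℓ)
  Separable f = ∀ z q → (∀ y → f y ≈ (y - z) * ⟦ q ⟧ y) → ⟦ q ⟧ z ≉ 0#

  separable⇒distinct : ∀ {f} → Separable f → ∀ r zs → (∀ y → f y ≈ ⟦ r ⟧ y * ∏X- zs y) →
    Distinct zs
  separable⇒distinct sep r []       _ = []
  separable⇒distinct {f} sep r (z ∷ zs) f≈r∏ =
    ∏X-≉0⇒avoids zs (λ e → sep z q f≈[X-z]q (trans (⟦⟧-⊛ r ∏[X- zs ] z) (trans (*-congˡ (trans (⟦⟧-∏ zs z) e)) (zeroʳ _))))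
    ∷ separable⇒distinct sep (X- z * r) zs f≈[X-z]r∏
    where
    q : Poly K
    q = r ⊛ ∏[X- zs ]
    f≈[X-z]q : ∀ y → f y ≈ (y - z) * ⟦ q ⟧ y
    f≈[X-z]q y = begin
      f y                                  ≈⟨ f≈r∏ y ⟩
      ⟦ r ⟧ y * ((y - z) * ∏X- zs y)
        ≈⟨ solve 4 (λ R y z P → R :* ((y :- z) :* P) := (y :- z) :* (R :* P)) refl (⟦ r ⟧ y) y z (∏X- zs y) ⟩
      (y - z) * (⟦ r ⟧ y * ∏X- zs y)        ≈⟨ *-congˡ (trans (⟦⟧-⊛ r ∏[X- zs ] y) (*-congˡ (⟦⟧-∏ zs y))) ⟨
      (y - z) * ⟦ q ⟧ y                     ∎
    f≈[X-z]r∏ : ∀ y → f y ≈ ⟦ X- z * r ⟧ y * ∏X- zs y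
    f≈[X-z]r∏ y = begin
      f y                               ≈⟨ f≈r∏ y ⟩
      ⟦ r ⟧ y * ((y - z) * ∏X- zs y)
        ≈⟨ solve 4 (λ R y z P → R :* ((y :- z) :* P) := ((y :- z) :* R) :* P) refl (⟦ r ⟧ y) y z (∏X- zs y) ⟩
      ((y - z) * ⟦ r ⟧ y) * ∏X- zs y     ≈⟨ *-congʳ (⟦⟧-X-* z r y) ⟨
      ⟦ X- z * r ⟧ y * ∏X- zs y          ∎

  geometric : Carrier → ℕ → Poly K
  geometric z zero    = []
  geometric z (suc n) = z ^ n ∷ geometric z n

  [X-z]*geometric : ∀ z n y → (y - z) * ⟦ geometric z n ⟧ y ≈ y ^ n - z ^ n
  [X-z]*geometric z zero    y = solve 2 (λ y z → (y :- z) :* con (+ 0) := con (+ 1) :- con (+ 1)) refl y z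
  [X-z]*geometric z (suc n) y = begin
    (y - z) * (z ^ n + y * G)
      ≈⟨ solve 4 (λ y z Z G → (y :- z) :* (Z :+ y :* G) := (y :- z) :* Z :+ y :* ((y :- z) :* G)) refl y z (z ^ n) G ⟩
    (y - z) * z ^ n + y * ((y - z) * G)      ≈⟨ +-congˡ (*-congˡ ([X-z]*geometric z n y)) ⟩
    (y - z) * z ^ n + y * (y ^ n - z ^ n)
      ≈⟨ solve 4 (λ y z Z Y → (y :- z) :* Z :+ y :* (Y :- Z) := y :* Y :- z :* Z) refl y z (z ^ n) (y ^ n) ⟩
    y * y ^ n - z * z ^ n                    ∎
    where G = ⟦ geometric z n ⟧ y

  ⟦geometric⟧-at-z : ∀ z n → ⟦ geometric z (suc n) ⟧ z ≈ natCast K (suc n) * z ^ n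
  ⟦geometric⟧-at-z z zero    = solve 1 (λ z → con (+ 1) :+ z :* con (+ 0) := (con (+ 1) :+ con (+ 0)) :* con (+ 1)) refl z
  ⟦geometric⟧-at-z z (suc n) = trans (+-congˡ (*-congˡ (⟦geometric⟧-at-z z n)))
    (solve 3 (λ z Z N → z :* Z :+ z :* (N :* Z) := (con (+ 1) :+ N) :* (z :* Z)) refl z (z ^ n) (natCast K (suc n)))

  binomial : Carrier → ℕ → Poly K
  binomial v a = 1# ∷ monomial a (- v)

  ⟦⟧-binomial : ∀ v a y → ⟦ binomial v a ⟧ y ≈ 1# - v * y ^ suc a
  ⟦⟧-binomial v a y = trans (+-congˡ (*-congˡ (⟦⟧-monomial a (- v) y)))
    (solve 3 (λ y v Y → con (+ 1) :+ y :* (:- v :* Y) := con (+ 1) :- v :* (y :* Y)) refl y v (y ^ a))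

  lead-binomial : ∀ v a → lead (binomial v a) ≡ - v
  lead-binomial v a = go 1# a
    where
    go : ∀ b n → lead (b ∷ monomial n (- v)) ≡ - v
    go b zero    = ≡.refl
    go b (suc n) = go 0# n

  length-binomial : ∀ v a → length (binomial v a) ≡ suc (suc a)
  length-binomial v a = ≡.cong suc (length-monomial a (- v))

  record Zeros (v : Carrier) (a : ℕ) : Set (c ⊔ ℓ) where
    field
      points        : List Carrier
      length-points : length points ≡ suc a
      distinct      : Distinct points
      vanishing     : All (λ z → ⟦ binomial v a ⟧ z ≈ 0#) points
      complete      : ∀ z → ⟦ binomial v a ⟧ z ≈ 0# → ∏X- points z ≈ 0#

  module CharacteristicZero (char0 : CharZero K) where

    natCast-injective : ∀ m n → natCast K m ≈ natCast K n → m ≡ n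
    natCast-injective zero    zero    _ = ≡.refl
    natCast-injective zero    (suc n) e = ⊥-elim (char0 n (sym e))
    natCast-injective (suc m) zero    e = ⊥-elim (char0 m e)
    natCast-injective (suc m) (suc n) e = ≡.cong suc (natCast-injective m n (+-cancelˡ 1# _ _ e))

    shifts : Carrier → ℕ → List Carrier
    shifts x zero    = []
    shifts x (suc n) = x + natCast K (suc n) ∷ shifts x n

    length-shifts : ∀ x n → length (shifts x n) ≡ n
    length-shifts x zero    = ≡.refl
    length-shifts x (suc n) = ≡.cong suc (length-shifts x n)

    shift-injective : ∀ {x i j} → x + natCast K i ≈ x + natCast K j → i ≡ j
    shift-injective e = natCast-injective _ _ (+-cancelˡ _ _ _ e)

    shifts-all : ∀ x n (P : Carrier → Set ℓ) → (∀ i → 1 ≤ i → i ≤ n → P (x + natCast K i)) →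
      All P (shifts x n)
    shifts-all x zero    P f = []
    shifts-all x (suc n) P f =
      f (suc n) (s≤s z≤n) ℕ.≤-refl ∷ shifts-all x n P (λ i 1≤i i≤n → f i 1≤i (ℕ.m≤n⇒m≤1+n i≤n))

    shifts-distinct : ∀ x n → Distinct (shifts x n)
    shifts-distinct x zero    = []
    shifts-distinct x (suc n) =
      shifts-all x n _ (λ i _ i≤n e → ℕ.1+n≰n (≡.subst (_≤ n) (shift-injective (sym e)) i≤n))
      ∷ shifts-distinct x n

    shifts-avoid : ∀ x n → All (_≉ x) (shifts x n)
    shifts-avoid x n = shifts-all x n _
      (λ i 1≤i _ e → ℕ.1+n≰n (≡.subst (1 ≤_) (shift-injective {j = 0} (trans e (sym (+-identityʳ x)))) 1≤i))

    -- x + 1, …, x + length p are distinct points different from x.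
    vanishes-off⇒vanishes-at : ∀ p x → (∀ y → y ≉ x → ⟦ p ⟧ y ≈ 0#) → ⟦ p ⟧ x ≈ 0#
    vanishes-off⇒vanishes-at p x p≈0 =
      vanishes-everywhere (shifts-distinct x n) p (ℕ.≤-reflexive (≡.sym (length-shifts x n)))
        (All.map (p≈0 _) (shifts-avoid x n)) x
      where n = length p

    -- With S = (X^m - z^m)/(X - z) we get (X - z)(q + v S) = f - f(z) = 0, so
    -- q + v S vanishes off z, hence at z; then q(z) = 0 would force
    -- m z^(m-1) = S(z) = 0.
    binomial-separable : ∀ {v} a → v ≉ 0# → Separable ⟦ binomial v a ⟧
    binomial-separable {v} a v≉0 z q f≈[X-z]q qz≈0 =
      ^-nonzero z≉0 a (x*y≈0⇒y≈0 (char0 a) (trans (sym (⟦geometric⟧-at-z z a)) Sz≈0))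
      where
      f : Carrier → Carrier
      f = ⟦ binomial v a ⟧
      S : Poly K
      S = geometric z (suc a)
      fz≈0 : f z ≈ 0#
      fz≈0 = trans (f≈[X-z]q z) (trans (*-congʳ (-‿inverseʳ z)) (zeroˡ _))
      z≉0 : z ≉ 0#
      z≉0 z≈0 = 1≉0 (begin
        1#                 ≈⟨ x∙y⁻¹≈ε⇒x≈y _ _ (trans (sym (⟦⟧-binomial v a z)) fz≈0) ⟩
        v * (z * z ^ a)    ≈⟨ *-congˡ (trans (*-congʳ z≈0) (zeroˡ _)) ⟩
        v * 0#             ≈⟨ zeroʳ v ⟩
        0#                 ∎)
      E : Poly K
      E = q ⊕ scale v S
      [X-z]E≈0 : ∀ y → (y - z) * ⟦ E ⟧ y ≈ 0#
      [X-z]E≈0 y = begin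
        (y - z) * ⟦ E ⟧ y
          ≈⟨ *-congˡ (trans (⟦⟧-⊕ q (scale v S) y) (+-congˡ (⟦⟧-scale v S y))) ⟩
        (y - z) * (⟦ q ⟧ y + v * ⟦ S ⟧ y)
          ≈⟨ solve 5 (λ y z Q v S → (y :- z) :* (Q :+ v :* S) := (y :- z) :* Q :+ v :* ((y :- z) :* S))
              refl y z (⟦ q ⟧ y) v (⟦ S ⟧ y) ⟩
        (y - z) * ⟦ q ⟧ y + v * ((y - z) * ⟦ S ⟧ y)
          ≈⟨ +-cong (trans (sym (f≈[X-z]q y)) (⟦⟧-binomial v a y)) (*-congˡ ([X-z]*geometric z (suc a) y)) ⟩
        (1# - v * y ^ suc a) + v * (y ^ suc a - z ^ suc a)
          ≈⟨ solve 3 (λ v Y Z → (con (+ 1) :- v :* Y) :+ v :* (Y :- Z) := con (+ 1) :- v :* Z)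
              refl v (y ^ suc a) (z ^ suc a) ⟩
        1# - v * z ^ suc a                             ≈⟨ trans (sym (⟦⟧-binomial v a z)) fz≈0 ⟩
        0#                                             ∎
      Ez≈0 : ⟦ E ⟧ z ≈ 0#
      Ez≈0 = vanishes-off⇒vanishes-at E z (λ y y≉z → x*y≈0⇒y≈0 (λ e → y≉z (x∙y⁻¹≈ε⇒x≈y _ _ e)) ([X-z]E≈0 y))
      Sz≈0 : ⟦ S ⟧ z ≈ 0#
      Sz≈0 = x*y≈0⇒y≈0 v≉0 (begin
        v * ⟦ S ⟧ z                ≈⟨ +-identityˡ _ ⟨
        0# + v * ⟦ S ⟧ z           ≈⟨ +-congʳ qz≈0 ⟨
        ⟦ q ⟧ z + v * ⟦ S ⟧ z      ≈⟨ trans (⟦⟧-⊕ q (scale v S) z) (+-congˡ (⟦⟧-scale v S z)) ⟨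
        ⟦ E ⟧ z                    ≈⟨ Ez≈0 ⟩
        0#                         ∎)

    binomial-zeros : AlgClosed K → ∀ {v} a → v ≉ 0# → Zeros v a
    binomial-zeros closed {v} a v≉0
      with splits closed (suc a) (binomial v a) (length-binomial v a)
             (λ e → -‿nonzero v≉0 (trans (reflexive (≡.sym (lead-binomial v a))) e))
    ... | zs , length-zs , f≈l∏ = record
      { points        = zs
      ; length-points = length-zs
      ; distinct      = separable⇒distinct (binomial-separable a v≉0) (- v ∷ []) zs
                          (λ y → trans (f≈-v∏ y) (*-congʳ (sym (trans (+-congˡ (zeroʳ y)) (+-identityʳ _)))))
      ; vanishing     = All.map (λ {z} ∏≈0 → trans (f≈-v∏ z) (trans (*-congˡ ∏≈0) (zeroʳ _))) ∏X-≈0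
      ; complete      = λ z fz≈0 → x*y≈0⇒y≈0 (-‿nonzero v≉0) (trans (sym (f≈-v∏ z)) fz≈0)
      }
      where
      f≈-v∏ : ∀ y → ⟦ binomial v a ⟧ y ≈ - v * ∏X- zs y
      f≈-v∏ y = trans (f≈l∏ y) (*-congʳ (reflexive (lead-binomial v a)))

  -- Substituting X^M and reducing modulo X^(a+1) = r

  module SubstitutePower (a M : ℕ) (r : Carrier) where

    -- The reduction of Σᵢ pᵢ X^(M(j+i)): X^n becomes r^(n / (a+1)) X^(n mod (a+1)).
    substitute : ℕ → Poly K → Poly K
    substitute j []      = []
    substitute j (x ∷ p) = monomial (j ℕ.* M % suc a) (x * r ^ (j ℕ.* M / suc a)) ⊕ substitute (suc j) p

    length-substitute : ∀ j p → length (substitute j p) ≤ suc a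
    length-substitute j []      = z≤n
    length-substitute j (x ∷ p) = length-⊕ (monomial n _) (substitute (suc j) p)
      (ℕ.≤-trans (ℕ.≤-reflexive (length-monomial n _)) (m%n<n (j ℕ.* M) (suc a))) (length-substitute (suc j) p)
      where n = j ℕ.* M % suc a

    module _ {y} (y^m≈r : y ^ suc a ≈ r) where

      ^-reduce : ∀ n → y ^ n ≈ r ^ (n / suc a) * y ^ (n % suc a)
      ^-reduce n = begin
        y ^ n                                           ≡⟨ ≡.cong (y ^_) (m≡m%n+[m/n]*n n (suc a)) ⟩
        y ^ (n % suc a ℕ.+ n / suc a ℕ.* suc a)          ≈⟨ ^-homo-* y (n % suc a) _ ⟩
        y ^ (n % suc a) * y ^ (n / suc a ℕ.* suc a)      ≈⟨ *-congˡ (^-congʳ y (ℕ.*-comm (n / suc a) (suc a))) ⟩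
        y ^ (n % suc a) * y ^ (suc a ℕ.* (n / suc a))    ≈⟨ *-congˡ (^-assocʳ y (suc a) (n / suc a)) ⟨
        y ^ (n % suc a) * (y ^ suc a) ^ (n / suc a)      ≈⟨ *-congˡ (^-congˡ (n / suc a) y^m≈r) ⟩
        y ^ (n % suc a) * r ^ (n / suc a)                ≈⟨ *-comm _ _ ⟩
        r ^ (n / suc a) * y ^ (n % suc a)                ∎

      ⟦⟧-substitute : ∀ j p → ⟦ substitute j p ⟧ y ≈ y ^ (j ℕ.* M) * ⟦ p ⟧ (y ^ M)
      ⟦⟧-substitute j []      = sym (zeroʳ _)
      ⟦⟧-substitute j (x ∷ p) = begin
        ⟦ monomial (n % suc a) (x * r ^ (n / suc a)) ⊕ substitute (suc j) p ⟧ y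
          ≈⟨ ⟦⟧-⊕ (monomial (n % suc a) (x * r ^ (n / suc a))) (substitute (suc j) p) y ⟩
        ⟦ monomial (n % suc a) (x * r ^ (n / suc a)) ⟧ y + ⟦ substitute (suc j) p ⟧ y
          ≈⟨ +-cong (⟦⟧-monomial (n % suc a) _ y) (⟦⟧-substitute (suc j) p) ⟩
        (x * r ^ (n / suc a)) * y ^ (n % suc a) + y ^ (M ℕ.+ n) * ⟦ p ⟧ Y
          ≈⟨ +-cong (trans (*-assoc _ _ _) (*-congˡ (sym (^-reduce n)))) (*-congʳ (^-homo-* y M n)) ⟩
        x * y ^ n + (Y * y ^ n) * ⟦ p ⟧ Y
          ≈⟨ solve 4 (λ x Yn Y P → x :* Yn :+ (Y :* Yn) :* P := Yn :* (x :+ Y :* P)) refl x (y ^ n) Y (⟦ p ⟧ Y) ⟩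
        y ^ n * (x + Y * ⟦ p ⟧ Y)                                          ∎
        where
        n : ℕ
        n = j ℕ.* M
        Y : Carrier
        Y = y ^ M

    -- As M is coprime to a + 1, jM is not a multiple of a + 1 when 0 < j ≤ a.
    substitute-higher-at-0 : Coprime M (suc a) → ∀ j p → 1 ≤ j → j ℕ.+ length p ≤ suc a →
      ⟦ substitute j p ⟧ 0# ≈ 0#
    substitute-higher-at-0 coprime j []      _   _    = refl
    substitute-higher-at-0 coprime j (x ∷ p) 1≤j j+p≤m = begin
      ⟦ monomial (j ℕ.* M % suc a) _ ⊕ substitute (suc j) p ⟧ 0#
        ≈⟨ ⟦⟧-⊕ (monomial (j ℕ.* M % suc a) _) (substitute (suc j) p) 0# ⟩
      ⟦ monomial (j ℕ.* M % suc a) _ ⟧ 0# + ⟦ substitute (suc j) p ⟧ 0#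
        ≈⟨ +-cong (⟦monomial⟧-at-0 _ _ jM%m≢0) (substitute-higher-at-0 coprime (suc j) p (s≤s z≤n) 1+j+p≤m) ⟩
      0# + 0#                                                     ≈⟨ +-identityˡ 0# ⟩
      0#                                                          ∎
      where
      1+j+p≤m : suc j ℕ.+ length p ≤ suc a
      1+j+p≤m = ≡.subst (_≤ suc a) (ℕ.+-suc j (length p)) j+p≤m
      j<m : j < suc a
      j<m = ℕ.<-≤-trans (ℕ.m<m+n j (s≤s z≤n)) j+p≤m
      jM%m≢0 : j ℕ.* M % suc a ≢ 0
      jM%m≢0 e = ℕ.<⇒≱ j<m (∣⇒≤ {{ℕ.>-nonZero 1≤j}}
        (coprime-divisor (Coprimality.sym coprime) (≡.subst (suc a ∣_) (ℕ.*-comm j M) (m%n≡0⇒n∣m _ (suc a) e))))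

    substitute-at-0 : Coprime M (suc a) → ∀ x p → length (x ∷ p) ≤ suc a →
      ⟦ substitute 0 (x ∷ p) ⟧ 0# ≈ x
    substitute-at-0 coprime x p x∷p≤m = begin
      ⟦ monomial 0 (x * 1#) ⊕ substitute 1 p ⟧ 0#            ≈⟨ ⟦⟧-⊕ (monomial 0 (x * 1#)) (substitute 1 p) 0# ⟩
      ⟦ monomial 0 (x * 1#) ⟧ 0# + ⟦ substitute 1 p ⟧ 0#
        ≈⟨ +-congˡ (substitute-higher-at-0 coprime 1 p ℕ.≤-refl x∷p≤m) ⟩
      ⟦ monomial 0 (x * 1#) ⟧ 0# + 0#
        ≈⟨ solve 1 (λ x → (x :* con (+ 1) :+ con (+ 0) :* con (+ 0)) :+ con (+ 0) := x) refl x ⟩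
      x                                                    ∎

  -- Constant terms

  IsZeroOf≡ : ∀ v m z → IsZeroOf K v m z ≡ (1# - v * z ^ m ≈ 0#)
  IsZeroOf≡ v m z = ≡.cong (λ t → 1# - v * t ≈ 0#) (pow≡^ z m)

  IsZeroOf⇒binomial-zero : ∀ {v a z} → IsZeroOf K v (suc a) z → ⟦ binomial v a ⟧ z ≈ 0#
  IsZeroOf⇒binomial-zero {v} {a} {z} isZero = trans (⟦⟧-binomial v a z) (≡.subst id (IsZeroOf≡ v (suc a) z) isZero)

  binomial-zero⇒IsZeroOf : ∀ {v a z} → ⟦ binomial v a ⟧ z ≈ 0# → IsZeroOf K v (suc a) z
  binomial-zero⇒IsZeroOf {v} {a} {z} fz≈0 = ≡.subst id (≡.sym (IsZeroOf≡ v (suc a) z)) (trans (sym (⟦⟧-binomial v a z)) fz≈0)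

  IsZeroOf⇒*≈1 : ∀ {v m z} → IsZeroOf K v m z → v * z ^ m ≈ 1#
  IsZeroOf⇒*≈1 {v} {m} {z} isZero = sym (x∙y⁻¹≈ε⇒x≈y _ _ (≡.subst id (IsZeroOf≡ v m z) isZero))

  *≈1⇒IsZeroOf : ∀ {v m z} → v * z ^ m ≈ 1# → IsZeroOf K v m z
  *≈1⇒IsZeroOf {v} {m} {z} vz^m≈1 = ≡.subst id (≡.sym (IsZeroOf≡ v m z)) (x≈y⇒x∙y⁻¹≈ε (sym vz^m≈1))

  IsZeroOf-pow : ∀ {u w} m M {y} → pow K w M ≈ u → IsZeroOf K w m y → IsZeroOf K u m (pow K y M)
  IsZeroOf-pow {u} {w} m M {y} w^M≈u isZero rewrite pow≡^ y M | pow≡^ w M = *≈1⇒IsZeroOf {u} {m} {y ^ M} (begin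
    u * (y ^ M) ^ m          ≈⟨ *-cong (sym w^M≈u) (^-assocʳ y M m) ⟩
    w ^ M * y ^ (M ℕ.* m)    ≈⟨ *-congˡ (trans (^-congʳ y (ℕ.*-comm M m)) (sym (^-assocʳ y m M))) ⟩
    w ^ M * (y ^ m) ^ M      ≈⟨ ^-distrib-* w (y ^ m) M ⟨
    (w * y ^ m) ^ M          ≈⟨ ^-congˡ M (IsZeroOf⇒*≈1 {w} {m} {y} isZero) ⟩
    1# ^ M                   ≈⟨ 1^n≈1 M ⟩
    1#                       ∎)

  IsCT-substitute-power : ∀ {u w t} {g h : Carrier → Carrier} a k → Coprime (suc k) (suc a) →
    w ≉ 0# → pow K w (suc k) ≈ u → IsCT K u (suc a) g h t →
    IsCT K w (suc a) (λ y → g (pow K y (suc k))) (λ y → h (pow K y (suc k))) t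
  IsCT-substitute-power {u} {w} {t} {g} {h} a k coprime w≉0 w^M≈u (x ∷ A , A-fits , t≈A0)
    with inverse w w≉0
  ... | w⁻¹ , ww⁻¹≈1 = pad B length-B , B-fits , t≈B0
    where
    open SubstitutePower a (suc k) w⁻¹
    xA : Poly K
    xA = x ∷ toList A
    length-xA : length xA ≤ suc a
    length-xA = ℕ.≤-reflexive (≡.cong suc (length-toList A))
    B : Poly K
    B = substitute 0 xA
    length-B : length B ≤ suc a
    length-B = length-substitute 0 xA
    y^m≈w⁻¹ : ∀ {y} → w * y ^ suc a ≈ 1# → y ^ suc a ≈ w⁻¹
    y^m≈w⁻¹ {y} wy^m≈1 = begin
      y ^ suc a                 ≈⟨ *-identityˡ _ ⟨
      1# * y ^ suc a            ≈⟨ *-congʳ (trans (*-comm w⁻¹ w) ww⁻¹≈1) ⟨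
      (w⁻¹ * w) * y ^ suc a     ≈⟨ *-assoc w⁻¹ w _ ⟩
      w⁻¹ * (w * y ^ suc a)     ≈⟨ *-congˡ wy^m≈1 ⟩
      w⁻¹ * 1#                  ≈⟨ *-identityʳ w⁻¹ ⟩
      w⁻¹                       ∎
    B-fits : ∀ y → IsZeroOf K w (suc a) y →
      ⟦ toList (pad B length-B) ⟧ y * h (pow K y (suc k)) ≈ g (pow K y (suc k))
    B-fits y isZero = begin
      ⟦ toList (pad B length-B) ⟧ y * h Y    ≈⟨ *-congʳ (⟦⟧-pad B length-B y) ⟩
      ⟦ B ⟧ y * h Y
        ≈⟨ *-congʳ (⟦⟧-substitute (y^m≈w⁻¹ (IsZeroOf⇒*≈1 {w} {suc a} {y} isZero)) 0 xA) ⟩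
      (1# * ⟦ xA ⟧ (y ^ suc k)) * h Y
        ≈⟨ *-congʳ (trans (*-identityˡ _) (⟦⟧-cong xA (reflexive (≡.sym (pow≡^ y (suc k)))))) ⟩
      ⟦ xA ⟧ Y * h Y                         ≈⟨ A-fits Y (IsZeroOf-pow (suc a) (suc k) w^M≈u isZero) ⟩
      g Y                                    ∎
      where Y = pow K y (suc k)
    t≈B0 : t ≈ ⟦ toList (pad B length-B) ⟧ 0#
    t≈B0 = begin
      t                                     ≈⟨ t≈A0 ⟩
      x + 0# * ⟦ toList A ⟧ 0#              ≈⟨ trans (+-congˡ (zeroˡ _)) (+-identityʳ x) ⟩
      x                                     ≈⟨ substitute-at-0 coprime x (toList A) length-xA ⟨
      ⟦ B ⟧ 0#                              ≈⟨ ⟦⟧-pad B length-B 0# ⟨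
      ⟦ toList (pad B length-B) ⟧ 0#        ∎

  IsCT-exists : AlgClosed K → CharZero K → ∀ {v} a → v ≉ 0# → (N D : Poly K) →
    (∀ z → IsZeroOf K v (suc a) z → ⟦ D ⟧ z ≉ 0#) → ∃ (IsCT K v (suc a) ⟦ N ⟧ ⟦ D ⟧)
  IsCT-exists closed char0 {v} a v≉0 N D D≉0 = ⟦ toList A ⟧ 0# , A , A-fits , refl
    where
    open Zeros (CharacteristicZero.binomial-zeros char0 closed a v≉0)
    interpolant : ∃ λ p → length p ≤ length points × All (λ z → ⟦ p ⟧ z * ⟦ D ⟧ z ≈ ⟦ N ⟧ z) points
    interpolant = interpolate distinct ⟦ N ⟧ ⟦ D ⟧
      (All.map (λ {z} isZero → D≉0 z (binomial-zero⇒IsZeroOf {v} {a} {z} isZero)) vanishing)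
    p : Poly K
    p = proj₁ interpolant
    p≤m : length p ≤ suc a
    p≤m = ≡.subst (length p ≤_) length-points (proj₁ (proj₂ interpolant))
    A : Vec Carrier (suc a)
    A = pad p p≤m
    F : Poly K
    F = p ⊛ D ⊝ N
    ⟦F⟧ : ∀ y → ⟦ F ⟧ y ≈ ⟦ p ⟧ y * ⟦ D ⟧ y - ⟦ N ⟧ y
    ⟦F⟧ y = trans (⟦⟧-⊝ (p ⊛ D) N y) (+-congʳ (⟦⟧-⊛ p D y))
    F-vanishing : All (λ z → ⟦ F ⟧ z ≈ 0#) points
    F-vanishing = All.map (λ {x} fits → trans (⟦F⟧ x) (x≈y⇒x∙y⁻¹≈ε fits)) (proj₂ (proj₂ interpolant))
    A-fits : ∀ z → IsZeroOf K v (suc a) z → ⟦ toList A ⟧ z * ⟦ D ⟧ z ≈ ⟦ N ⟧ z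
    A-fits z isZero = trans (*-congʳ (⟦⟧-pad p p≤m z)) (x∙y⁻¹≈ε⇒x≈y _ _ (trans (sym (⟦F⟧ z))
      (vanishes-at-zeros-of-∏ distinct F F-vanishing (complete z (IsZeroOf⇒binomial-zero {v} {a} {z} isZero)))))

  IsCT-unique : AlgClosed K → CharZero K → ∀ {v t s} {g h : Carrier → Carrier} a → v ≉ 0# →
    (∀ z → IsZeroOf K v (suc a) z → h z ≉ 0#) →
    IsCT K v (suc a) g h t → IsCT K v (suc a) g h s → t ≈ s
  IsCT-unique closed char0 {v} {t} {s} {g} {h} a v≉0 h≉0 (A , A-fits , t≈A0) (B , B-fits , s≈B0) = begin
    t                              ≈⟨ t≈A0 ⟩
    ⟦ toList A ⟧ 0#                ≈⟨ x∙y⁻¹≈ε⇒x≈y _ _ (trans (sym (⟦⟧-⊝ (toList A) (toList B) 0#)) C0≈0) ⟩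
    ⟦ toList B ⟧ 0#                ≈⟨ s≈B0 ⟨
    s                              ∎
    where
    open Zeros (CharacteristicZero.binomial-zeros char0 closed a v≉0)
    C : Poly K
    C = toList A ⊝ toList B
    length-C : length C ≤ length points
    length-C = ≡.subst (length C ≤_) (≡.sym length-points) (length-⊕ (toList A) _
      (ℕ.≤-reflexive (length-toList A))
      (ℕ.≤-reflexive (≡.trans (length-scale (- 1#) (toList B)) (length-toList B))))
    C-zero : ∀ {z} → ⟦ binomial v a ⟧ z ≈ 0# → ⟦ C ⟧ z ≈ 0#
    C-zero {z} fz≈0 = x*y≈0⇒y≈0 (h≉0 z isZero) (begin
      h z * ⟦ C ⟧ z                                ≈⟨ *-congˡ (⟦⟧-⊝ (toList A) (toList B) z) ⟩
      h z * (⟦ toList A ⟧ z - ⟦ toList B ⟧ z)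
        ≈⟨ solve 3 (λ H P Q → H :* (P :- Q) := P :* H :- Q :* H) refl (h z) (⟦ toList A ⟧ z) (⟦ toList B ⟧ z) ⟩
      ⟦ toList A ⟧ z * h z - ⟦ toList B ⟧ z * h z   ≈⟨ x≈y⇒x∙y⁻¹≈ε (trans (A-fits z isZero) (sym (B-fits z isZero))) ⟩
      0#                                            ∎)
      where isZero = binomial-zero⇒IsZeroOf {v} {a} {z} fz≈0
    C0≈0 : ⟦ C ⟧ 0# ≈ 0#
    C0≈0 = vanishes-everywhere distinct C length-C (All.map C-zero vanishing) 0#

proposition3 : ∀ {c ℓ : Level} (K : Field c ℓ) → CharZero K → AlgClosed K →
    (u : Field.Carrier K) → ¬ (Field._≈_ K u (Field.0# K)) →
    (a k : ℕ) → gcd (suc k) (suc a) ≡ 1 →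
    (N D : Poly K) →
    (∀ z → IsZeroOf K u (suc a) z → ¬ (Field._≈_ K (eval K D z) (Field.0# K))) →
    (w : Field.Carrier K) → Field._≈_ K (pow K w (suc k)) u →
    Σ (Field.Carrier K) (λ t →
        IsCT K u (suc a) (eval K N) (eval K D) t ×
        IsCT K w (suc a) (λ z → eval K N (pow K z (suc k)))
                         (λ z → eval K D (pow K z (suc k))) t)
    × (∀ t s → IsCT K u (suc a) (eval K N) (eval K D) t →
               IsCT K w (suc a) (λ z → eval K N (pow K z (suc k)))
                                (λ z → eval K D (pow K z (suc k))) s →
               Field._≈_ K t s)
proposition3 K char0 closed u u≉0 a k gcd≡1 N D D≉0 w w^k≈u =
  (t₀ , t₀-isCT , transfer t₀-isCT) ,
  λ t s t-isCT s-isCT → IsCT-unique closed char0 a w≉0 D[y^k]≉0 (transfer t-isCT) s-isCT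
  where
  open Field K
  open PolynomialsOver K
  open Σ (IsCT-exists closed char0 a u≉0 N D D≉0) renaming (proj₁ to t₀; proj₂ to t₀-isCT)
  w≉0 : w ≉ 0#
  w≉0 w≈0 = u≉0 (trans (sym w^k≈u) (trans (*-congʳ w≈0) (zeroˡ _)))
  transfer : ∀ {t} → IsCT K u (suc a) (eval K N) (eval K D) t →
    IsCT K w (suc a) (λ z → eval K N (pow K z (suc k))) (λ z → eval K D (pow K z (suc k))) t
  transfer = IsCT-substitute-power a k (gcd≡1⇒coprime gcd≡1) w≉0 w^k≈u
  D[y^k]≉0 : ∀ y → IsZeroOf K w (suc a) y → eval K D (pow K y (suc k)) ≉ 0#
  D[y^k]≉0 y isZero = D≉0 _ (IsZeroOf-pow (suc a) (suc k) w^k≈u isZero)
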